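{- Let $n$ be a positive integer, $p\le n$ a prime, and $m$ an integer. Then $$\sum_{\substack{j\in\mathbb{Z}\\0\le jp+m\le n}}(-1)^{jp+m}\binom{n}{jp+m}\equiv0\pmod p.$$ -}

module Defs where

open import Data.Nat as ℕ using (ℕ; zero; suc)
open import Data.Nat.Combinatorics using (_C_)
open import Data.Integer as ℤ using (ℤ; +_; _-_; _*_; _+_)
open import Data.Integer.Divisibility.Signed using (_∣_; _∣?_)
open import Relation.Nullary using (yes; no)

sign : ℕ → ℤ
sign zero = + 1
sign (suc k) = ℤ.- sign k

term : ℕ → ℕ → ℤ
term n k = sign k * + (n C k)

-- k is of the form j*p + m for some integer j  ⇔  p ∣ (k - m)
-- (j ↦ j*p + m is a bijection from {j ∈ ℤ | 0 ≤ jp+m ≤ n}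
--  onto {k ∈ {0..n} | p ∣ k - m} since p > 0).
-- altSum n p m k = Σ_{0 ≤ i < k, p ∣ i - m} (-1)^i binom(n,i)
altSumUpTo : ℕ → ℕ → ℤ → ℕ → ℤ
altSumUpTo n p m zero = + 0
altSumUpTo n p m (suc k) with (+ p) ∣? (+ k - m)
... | yes _ = altSumUpTo n p m k + term n k
... | no  _ = altSumUpTo n p m k

altSum : ℕ → ℕ → ℤ → ℤ
altSum n p m = altSumUpTo n p m (suc n)

module Submission where

open import Defs
open import Data.Nat using (ℕ; _≤_; _<_)
open import Data.Nat.Primality using (Prime)
open import Data.Integer using (ℤ; +_)
open import Data.Integer.Divisibility.Signed using (_∣_)

open import Data.Empty using (⊥-elim)
open import Data.Nat as ℕ using (zero; suc; _!; _∸_; z≤n; s≤s)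
import Data.Nat.Properties as ℕ
import Data.Nat.Divisibility as ℕ
open import Data.Nat.DivMod using (m/n*n≡m)
open import Data.Nat.Combinatorics
  using (_C_; nCk≡n!/k![n-k]!; k![n∸k]!∣n!; nCk+nC[k+1]≡[n+1]C[k+1]; nCn≡1; k>n⇒nCk≡0)
open import Data.Nat.Primality
  using (euclidsLemma; prime⇒nonZero; prime⇒nonTrivial; prime⇒irreducible)
open import Data.Integer as ℤ using (-[1+_]; _-_; _+_; _*_)
import Data.Integer.Properties as ℤ
import Data.Integer.Divisibility.Signed as ℤ
open import Data.Integer.Tactic.RingSolver using (solve-∀)
import Data.Sum as Sum
open import Data.Sum using (_⊎_; inj₁; inj₂; [_,_]′)
open import Relation.Binary.PropositionalEquality
open import Function using (id; _∘_)
open import Relation.Nullary using (¬_; yes; no)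

-- Modulo p, (1 + x)^(a + p) = (1 + x)^a (1 + x^p), so C(a + p, k) ≡ C(a, k) + C(a, k - p).
-- Multiplying by (-1)^k and summing over the residue class k ≡ m, which is stable under
-- k ↦ k + p, gives S(a + p) ≡ (1 + (-1)^p) S(a) for the class sum S; and p ∣ 1 + (-1)^p.

n∣n! : ∀ {n} → .{{ℕ.NonZero n}} → n ℕ.∣ n !
n∣n! {suc n} = ℕ.m∣m*n (n !)

prime∤! : ∀ {p n} → Prime p → n < p → p ℕ.∤ n !
prime∤! {p} {zero} pr _ = ℕ.>⇒∤ (ℕ.nonTrivial⇒n>1 p {{prime⇒nonTrivial pr}})
prime∤! {p} {suc n} pr n<p =
  [ ℕ.>⇒∤ n<p , prime∤! pr (ℕ.<-trans (ℕ.n<1+n n) n<p) ]′ ∘ euclidsLemma (suc n) (n !) pr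

prime∣C : ∀ {p k} → Prime p → 0 < k → k < p → p ℕ.∣ p C k
prime∣C {p} {k} pr 0<k k<p =
  [ id , ⊥-elim ∘ p∤k![p∸k]! ]′ (euclidsLemma (p C k) (k ! ℕ.* (p ∸ k) !) pr p∣C*k![p∸k]!)
  where
  k≤p = ℕ.<⇒≤ k<p

  p∤k![p∸k]! : p ℕ.∤ k ! ℕ.* (p ∸ k) !
  p∤k![p∸k]! = [ prime∤! pr k<p , prime∤! pr (ℕ.∸-monoʳ-< 0<k k≤p) ]′
             ∘ euclidsLemma (k !) ((p ∸ k) !) pr

  instance
    k![p∸k]!≢0 : ℕ.NonZero (k ! ℕ.* (p ∸ k) !)
    k![p∸k]!≢0 = ℕ.m*n≢0 (k !) ((p ∸ k) !) {{k ℕ.!≢0}} {{(p ∸ k) ℕ.!≢0}}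

  C*k![p∸k]!≡p! : (p C k) ℕ.* (k ! ℕ.* (p ∸ k) !) ≡ p !
  C*k![p∸k]!≡p! = trans (cong (ℕ._* (k ! ℕ.* (p ∸ k) !)) (nCk≡n!/k![n-k]! k≤p))
                        (m/n*n≡m (k![n∸k]!∣n! k≤p))

  p∣C*k![p∸k]! : p ℕ.∣ (p C k) ℕ.* (k ! ℕ.* (p ∸ k) !)
  p∣C*k![p∸k]! = subst (p ℕ.∣_) (sym C*k![p∸k]!≡p!) (n∣n! {{prime⇒nonZero pr}})

-- shiftedC d a k = C(a, k - d) is the coefficient of x^k in x^d (1 + x)^a; it vanishes for k < d.
shiftedC : ℕ → ℕ → ℕ → ℕ
shiftedC zero a k = a C k
shiftedC (suc d) a zero = 0
shiftedC (suc d) a (suc k) = shiftedC d a k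

shiftedC-< : ∀ {d k} a → k < d → shiftedC d a k ≡ 0
shiftedC-< {suc d} {zero} a _ = refl
shiftedC-< {suc d} {suc k} a (s≤s k<d) = shiftedC-< a k<d

shiftedC-+ : ∀ d a j → shiftedC d a (d ℕ.+ j) ≡ a C j
shiftedC-+ zero a j = refl
shiftedC-+ (suc d) a j = shiftedC-+ d a j

shiftedC-pascal : ∀ d a k →
                  shiftedC d (suc a) (suc k) ≡ shiftedC d a k ℕ.+ shiftedC d a (suc k)
shiftedC-pascal zero a k = sym (nCk+nC[k+1]≡[n+1]C[k+1] a k)
shiftedC-pascal (suc zero) a zero = refl
shiftedC-pascal (suc (suc d)) a zero = refl
shiftedC-pascal (suc d) a (suc k) = shiftedC-pascal d a k

C-diag : ∀ n j → n C (n ℕ.+ j) ≡ 0 C j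
C-diag n zero = trans (cong (n C_) (ℕ.+-identityʳ n)) (nCn≡1 n)
C-diag n (suc j) = k>n⇒nCk≡0 (ℕ.m<m+n n (s≤s z≤n))

module _ {p} (pr : Prime p) where

  private
    0<p : 0 < p
    0<p = ℕ.>-nonZero⁻¹ p {{prime⇒nonZero pr}}

  C-+p : ∀ a k → + p ∣ + ((a ℕ.+ p) C k) - (+ (a C k) + + shiftedC p a k)
  C-+p a zero rewrite shiftedC-< a 0<p = ℤ.∣ᵤ⇒∣ (p ℕ.∣0)
  C-+p zero (suc k) with suc k ℕ.<? p
  ... | yes k<p rewrite shiftedC-< 0 k<p =
    subst (λ c → + p ∣ + c) (sym (ℕ.+-identityʳ _)) (ℤ.∣ᵤ⇒∣ (prime∣C pr (s≤s z≤n) k<p))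
  ... | no k≮p = subst (λ k → + p ∣ + (p C k) - (+ (0 C k) + + shiftedC p 0 k))
                       (ℕ.m+[n∸m]≡n (ℕ.≮⇒≥ k≮p)) (above-p (suc k ∸ p))
    where
    above-p : ∀ j → + p ∣ + (p C (p ℕ.+ j)) - (+ (0 C (p ℕ.+ j)) + + shiftedC p 0 (p ℕ.+ j))
    above-p j rewrite C-diag p j | shiftedC-+ p 0 j | k>n⇒nCk≡0 (ℕ.≤-trans 0<p (ℕ.m≤m+n p j))
      = subst (+ p ∣_) (sym (ℤ.+-inverseʳ (+ (0 C j)))) (ℤ.∣ᵤ⇒∣ (p ℕ.∣0))
  C-+p (suc a) (suc k) =
    subst (+ p ∣_) (sym splitting) (ℤ.∣m∣n⇒∣m+n (C-+p a k) (C-+p a (suc k)))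
    where
    splitting : + ((suc a ℕ.+ p) C suc k) - (+ (suc a C suc k) + + shiftedC p (suc a) (suc k))
              ≡ (+ ((a ℕ.+ p) C k) - (+ (a C k) + + shiftedC p a k))
                + (+ ((a ℕ.+ p) C suc k) - (+ (a C suc k) + + shiftedC p a (suc k)))
    splitting rewrite sym (nCk+nC[k+1]≡[n+1]C[k+1] (a ℕ.+ p) k)
                    | sym (nCk+nC[k+1]≡[n+1]C[k+1] a k)
                    | shiftedC-pascal p a k =
      regroup (+ ((a ℕ.+ p) C k)) (+ ((a ℕ.+ p) C suc k)) (+ (a C k)) (+ (a C suc k))
              (+ shiftedC p a k) (+ shiftedC p a (suc k))
      where
      regroup : ∀ x₁ x₂ y₁ y₂ z₁ z₂ →
        (x₁ + x₂) - ((y₁ + y₂) + (z₁ + z₂)) ≡ (x₁ - (y₁ + z₁)) + (x₂ - (y₂ + z₂))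
      regroup = solve-∀

  term-+p : ∀ a k → + p ∣ term (a ℕ.+ p) k - (term a k + sign k * + shiftedC p a k)
  term-+p a k =
    subst (+ p ∣_) (sym (factor (sign k) _ _ _)) (ℤ.∣n⇒∣m*n (sign k) (C-+p a k))
    where
    factor : ∀ s x y z → s * x - (s * y + s * z) ≡ s * (x - (y + z))
    factor = solve-∀

sign-+ : ∀ m n → sign (m ℕ.+ n) ≡ sign m * sign n
sign-+ zero n = sym (ℤ.*-identityˡ (sign n))
sign-+ (suc m) n = trans (cong ℤ.-_ (sign-+ m n)) (ℤ.neg-distribˡ-* (sign m) (sign n))

sign≡-1⊎2∣ : ∀ n → sign n ≡ -[1+ 0 ] ⊎ 2 ℕ.∣ n
sign≡-1⊎2∣ zero = inj₂ (2 ℕ.∣0)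
sign≡-1⊎2∣ (suc zero) = inj₁ refl
sign≡-1⊎2∣ (suc (suc n)) =
  Sum.map (trans (ℤ.neg-involutive (sign n))) (ℕ.∣m∣n⇒∣m+n ℕ.∣-refl) (sign≡-1⊎2∣ n)

prime∣1+sign : ∀ {p} → Prime p → + p ∣ + 1 + sign p
prime∣1+sign {p} pr with sign≡-1⊎2∣ p
... | inj₁ sign≡-1 rewrite sign≡-1 = ℤ.∣ᵤ⇒∣ (p ℕ.∣0)
... | inj₂ 2∣p with prime⇒irreducible pr 2∣p
...   | inj₂ refl = ℤ.∣-refl

module ResidueClassSum (d : ℕ) (r : ℤ) where

  InClass : ℕ → Set
  InClass k = + d ∣ + k - r

  InClass-+d : ∀ {k} → InClass k → InClass (d ℕ.+ k)
  InClass-+d {k} k∈ =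
    subst (+ d ∣_) (sym (ℤ.+-assoc (+ d) (+ k) (ℤ.- r))) (ℤ.∣m∣n⇒∣m+n ℤ.∣-refl k∈)

  InClass-+d⁻¹ : ∀ {k} → InClass (d ℕ.+ k) → InClass k
  InClass-+d⁻¹ {k} d+k∈ =
    ℤ.∣m+n∣m⇒∣n (subst (+ d ∣_) (ℤ.+-assoc (+ d) (+ k) (ℤ.- r)) d+k∈) ℤ.∣-refl

  classSum : (ℕ → ℤ) → ℕ → ℤ
  classSum f zero = + 0
  classSum f (suc k) with + d ℤ.∣? + k - r
  ... | yes _ = classSum f k + f k
  ... | no _ = classSum f k

  altSumUpTo≡classSum : ∀ n K → altSumUpTo n d r K ≡ classSum (term n) K
  altSumUpTo≡classSum n zero = refl
  altSumUpTo≡classSum n (suc k) with + d ℤ.∣? + k - r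
  ... | yes _ = cong (_+ term n k) (altSumUpTo≡classSum n k)
  ... | no _ = altSumUpTo≡classSum n k

  classSum-∈ : ∀ f k → InClass k → classSum f (suc k) ≡ classSum f k + f k
  classSum-∈ f k k∈ with + d ℤ.∣? + k - r
  ... | yes _ = refl
  ... | no k∉ = ⊥-elim (k∉ k∈)

  classSum-∉ : ∀ f k → ¬ InClass k → classSum f (suc k) ≡ classSum f k
  classSum-∉ f k k∉ with + d ℤ.∣? + k - r
  ... | yes k∈ = ⊥-elim (k∉ k∈)
  ... | no _ = refl

  classSum-skip : ∀ f k → f k ≡ + 0 → classSum f (suc k) ≡ classSum f k
  classSum-skip f k fk≡0 with + d ℤ.∣? + k - r
  ... | yes _ = trans (cong (λ x → classSum f k + x) fk≡0) (ℤ.+-identityʳ (classSum f k))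
  ... | no _ = refl

  classSum-+ : ∀ f g K → classSum (λ k → f k + g k) K ≡ classSum f K + classSum g K
  classSum-+ f g zero = refl
  classSum-+ f g (suc k) with + d ℤ.∣? + k - r
  ... | yes _ = trans (cong (_+ (f k + g k)) (classSum-+ f g k))
                      (interchange (classSum f k) (classSum g k) (f k) (g k))
    where
    interchange : ∀ x y u v → (x + y) + (u + v) ≡ (x + u) + (y + v)
    interchange = solve-∀
  ... | no _ = classSum-+ f g k

  classSum-*ˡ : ∀ c f K → classSum (λ k → c * f k) K ≡ c * classSum f K
  classSum-*ˡ c f zero = sym (ℤ.*-zeroʳ c)
  classSum-*ˡ c f (suc k) with + d ℤ.∣? + k - r
  ... | yes _ = trans (cong (_+ c * f k) (classSum-*ˡ c f k))
                      (sym (ℤ.*-distribˡ-+ c (classSum f k) (f k)))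
  ... | no _ = classSum-*ˡ c f k

  classSum-mod : ∀ {e} f g → (∀ k → e ∣ f k - g k) → ∀ K → e ∣ classSum f K - classSum g K
  classSum-mod f g f≡g zero = ℤ.∣ᵤ⇒∣ (ℕ._∣0 _)
  classSum-mod f g f≡g (suc k) with + d ℤ.∣? + k - r
  ... | yes _ = subst (_ ∣_) (sym (regroup (classSum f k) (f k) (classSum g k) (g k)))
                      (ℤ.∣m∣n⇒∣m+n (classSum-mod f g f≡g k) (f≡g k))
    where
    regroup : ∀ x u y v → (x + u) - (y + v) ≡ (x - y) + (u - v)
    regroup = solve-∀
  ... | no _ = classSum-mod f g f≡g k

  classSum-vanishing : ∀ f K → (∀ k → k < K → f k ≡ + 0) → classSum f K ≡ + 0
  classSum-vanishing f zero _ = refl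
  classSum-vanishing f (suc K) f≡0 =
    trans (classSum-skip f K (f≡0 K (ℕ.n<1+n K)))
          (classSum-vanishing f K (λ k k<K → f≡0 k (ℕ.m<n⇒m<1+n k<K)))

  classSum-tail : ∀ f L → (∀ j → f (L ℕ.+ j) ≡ + 0) →
                  ∀ j → classSum f (L ℕ.+ j) ≡ classSum f L
  classSum-tail f L f≡0 zero = cong (classSum f) (ℕ.+-identityʳ L)
  classSum-tail f L f≡0 (suc j) =
    trans (cong (classSum f) (ℕ.+-suc L j))
          (trans (classSum-skip f (L ℕ.+ j) (f≡0 j)) (classSum-tail f L f≡0 j))

  classSum-shift : ∀ f h → (∀ k → k < d → f k ≡ + 0) → (∀ j → f (d ℕ.+ j) ≡ h j) →
                   ∀ L → classSum f (d ℕ.+ L) ≡ classSum h L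
  classSum-shift f h f≡0 f≡h zero =
    trans (cong (classSum f) (ℕ.+-identityʳ d)) (classSum-vanishing f d f≡0)
  classSum-shift f h f≡0 f≡h (suc L) with + d ℤ.∣? + L - r
  ... | yes L∈ = begin
    classSum f (d ℕ.+ suc L)             ≡⟨ cong (classSum f) (ℕ.+-suc d L) ⟩
    classSum f (suc (d ℕ.+ L))           ≡⟨ classSum-∈ f (d ℕ.+ L) (InClass-+d L∈) ⟩
    classSum f (d ℕ.+ L) + f (d ℕ.+ L)   ≡⟨ cong₂ _+_ (classSum-shift f h f≡0 f≡h L) (f≡h L) ⟩
    classSum h L + h L                   ∎
    where open ≡-Reasoning
  ... | no L∉ = begin
    classSum f (d ℕ.+ suc L)             ≡⟨ cong (classSum f) (ℕ.+-suc d L) ⟩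
    classSum f (suc (d ℕ.+ L))           ≡⟨ classSum-∉ f (d ℕ.+ L) (L∉ ∘ InClass-+d⁻¹) ⟩
    classSum f (d ℕ.+ L)                 ≡⟨ classSum-shift f h f≡0 f≡h L ⟩
    classSum h L                         ∎
    where open ≡-Reasoning

altSum-+p : ∀ {p} → Prime p → ∀ a m →
            + p ∣ altSum (a ℕ.+ p) p m - (+ 1 + sign p) * altSum a p m
altSum-+p {p} pr a m =
  subst₂ (λ x y → + p ∣ x - y) (sym (altSumUpTo≡classSum (a ℕ.+ p) K)) sum≡
         (classSum-mod (term (a ℕ.+ p)) (λ k → term a k + g k) (term-+p pr a) K)
  where
  open ResidueClassSum p m
  open ≡-Reasoning
  K = suc a ℕ.+ p
  g : ℕ → ℤ
  g k = sign k * + shiftedC p a k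
  S = classSum (term a) (suc a)

  term-beyond : ∀ j → term a (suc a ℕ.+ j) ≡ + 0
  term-beyond j rewrite k>n⇒nCk≡0 (s≤s (ℕ.m≤m+n a j)) = ℤ.*-zeroʳ (sign (suc a ℕ.+ j))

  g-below : ∀ k → k < p → g k ≡ + 0
  g-below k k<p rewrite shiftedC-< a k<p = ℤ.*-zeroʳ (sign k)

  g-above : ∀ j → g (p ℕ.+ j) ≡ sign p * term a j
  g-above j rewrite shiftedC-+ p a j | sign-+ p j = ℤ.*-assoc (sign p) (sign j) (+ (a C j))

  g-sum : classSum g K ≡ sign p * S
  g-sum = begin
    classSum g K                                 ≡⟨ cong (classSum g) (ℕ.+-comm (suc a) p) ⟩
    classSum g (p ℕ.+ suc a)                     ≡⟨ classSum-shift g _ g-below g-above (suc a) ⟩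
    classSum (λ j → sign p * term a j) (suc a)   ≡⟨ classSum-*ˡ (sign p) (term a) (suc a) ⟩
    sign p * S                                   ∎

  sum≡ : classSum (λ k → term a k + g k) K ≡ (+ 1 + sign p) * altSum a p m
  sum≡ = begin
    classSum (λ k → term a k + g k) K    ≡⟨ classSum-+ (term a) g K ⟩
    classSum (term a) K + classSum g K
      ≡⟨ cong₂ _+_ (classSum-tail (term a) (suc a) term-beyond p) g-sum ⟩
    S + sign p * S                       ≡⟨ collect S (sign p) ⟩
    (+ 1 + sign p) * S
      ≡⟨ cong ((+ 1 + sign p) *_) (altSumUpTo≡classSum a (suc a)) ⟨
    (+ 1 + sign p) * altSum a p m        ∎
    where
    collect : ∀ x s → x + s * x ≡ (+ 1 + s) * x
    collect = solve-∀

proposition14 : (n : ℕ) → 0 < n → (p : ℕ) → Prime p → p ≤ n →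
    (m : ℤ) → (+ p) ∣ altSum n p m
proposition14 n _ p pr p≤n m =
  subst (λ n → + p ∣ altSum n p m) (ℕ.m∸n+n≡m p≤n)
        (ℤ.∣m+n∣n⇒∣m (altSum-+p pr (n ∸ p) m)
                     (ℤ.∣m⇒∣-m (ℤ.∣m⇒∣m*n (altSum (n ∸ p) p m) (prime∣1+sign pr))))
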